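{- Let $k\ge 2$ be an integer and let $a,b,c,d$ be non-negative integers with $a+b=c+d=S\ge 2$ and $\{a,b\}\ne\{c,d\}$. Then \[ \bigl|a^k+b^k-c^k-d^k\bigr|\ \ge\ k(k-1)\,\lfloor S/2\rfloor^{k-2}\ \ge\ C_k\,S^{k-2},\qquad C_k=k(k-1)\,3^{2-k}. \] -}

module Defs where

open import Data.Nat using (ℕ; _+_; _*_; _∸_; _^_)
open import Data.Integer as ℤ using (ℤ; +_; ∣_∣)
open import Data.Product using (_×_)
open import Data.Sum using (_⊎_)
open import Relation.Binary.PropositionalEquality using (_≡_)

absDiffPow : ℕ → ℕ → ℕ → ℕ → ℕ → ℕ
absDiffPow k a b c d =
  ∣ (+ (a ^ k) ℤ.+ + (b ^ k)) ℤ.- (+ (c ^ k) ℤ.+ + (d ^ k)) ∣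

SamePair : ℕ → ℕ → ℕ → ℕ → Set
SamePair a b c d = (a ≡ c × b ≡ d) ⊎ (a ≡ d × b ≡ c)

-- Write k = 2 + m.  Sort both pairs by ⊔ and ⊓; equal maxima would make the pairs
-- equal, so after possibly swapping the pairs b < d ≤ c < a and a + b = c + d.  Since
-- x ↦ x ^ k has increasing differences, a pair with the same sum that is more
-- spread out has a larger power sum.  Hence it suffices to compare (c, d) with
-- (c + 1, d - 1): the gain is at least (c + 1) ^ k + (c - 1) ^ k - 2 c ^ k, which by
-- induction on m is at least k (k - 1) c ^ m, and c ≥ ⌊S/2⌋.  The second claim
-- is S ≤ 3 ⌊S/2⌋ for S ≥ 2.

{-# OPTIONS --safe #-}
module Submission where

open import Defs
open import Data.Nat using (ℕ; zero; suc; _+_; _*_; _∸_; _^_; _≤_; _<_; _/_; _%_; _⊔_; _⊓_; s≤s; s≤s⁻¹)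
open import Data.Nat.Properties
open import Data.Nat.DivMod using (m≡m%n+[m/n]*n; m%n<n; /-monoˡ-≤; m*n/n≡m)
open import Data.Nat.Tactic.RingSolver using (solve-∀)
open import Algebra.Properties.CommutativeSemigroup *-commutativeSemigroup using (interchange; x∙yz≈y∙xz)
open import Data.Integer as ℤ using (∣_∣; _⊖_)
import Data.Integer.Properties as ℤ
open import Data.Product using (_×_; _,_)
open import Data.Sum using (_⊎_; inj₁; inj₂)
open import Data.Empty using (⊥-elim)
open import Function using (id)
open import Relation.Nullary using (¬_)
open import Relation.Binary using (tri<; tri≈; tri>)
open import Relation.Binary.PropositionalEquality

m+n≡o+p∧o<m⇒n<p : ∀ {m n o p} → m + n ≡ o + p → o < m → n < p
m+n≡o+p∧o<m⇒n<p {m} {n} {o} {p} eq o<m = +-cancelˡ-< o n p (begin-strict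
  o + n  <⟨ +-monoˡ-< n o<m ⟩
  m + n  ≡⟨ eq ⟩
  o + p  ∎)
  where open ≤-Reasoning

⊔-⊓-sel : ∀ m n → (m ⊔ n ≡ m × m ⊓ n ≡ n) ⊎ (m ⊔ n ≡ n × m ⊓ n ≡ m)
⊔-⊓-sel m n with ≤-total n m
... | inj₁ n≤m = inj₁ (m≥n⇒m⊔n≡m n≤m , m≥n⇒m⊓n≡n n≤m)
... | inj₂ m≤n = inj₂ (m≤n⇒m⊔n≡n m≤n , m≤n⇒m⊓n≡m m≤n)

f[m]+f[n]≡f[m⊔n]+f[m⊓n] : ∀ (f : ℕ → ℕ) m n → f m + f n ≡ f (m ⊔ n) + f (m ⊓ n)
f[m]+f[n]≡f[m⊔n]+f[m⊓n] f m n with ⊔-⊓-sel m n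
... | inj₁ (⊔≡m , ⊓≡n) rewrite ⊔≡m | ⊓≡n = refl
... | inj₂ (⊔≡n , ⊓≡m) rewrite ⊔≡n | ⊓≡m = +-comm (f m) (f n)

m+n≡o⇒o/2≤m⊔n : ∀ m n {o} → m + n ≡ o → o / 2 ≤ m ⊔ n
m+n≡o⇒o/2≤m⊔n m n refl = begin
  (m + n) / 2                ≤⟨ /-monoˡ-≤ 2 (+-mono-≤ (m≤m⊔n m n) (m≤n⊔m m n)) ⟩
  ((m ⊔ n) + (m ⊔ n)) / 2    ≡⟨ cong (_/ 2) (double (m ⊔ n)) ⟩
  (m ⊔ n) * 2 / 2            ≡⟨ m*n/n≡m (m ⊔ n) 2 ⟩
  m ⊔ n                      ∎
  where
  open ≤-Reasoning
  double : ∀ x → x + x ≡ x * 2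
  double = solve-∀

^-supermodular : ∀ k b e u → (b + u) ^ k + (b + e) ^ k ≤ (b + e + u) ^ k + b ^ k
^-supermodular zero    b e u = ≤-refl
^-supermodular (suc k) b e u = begin
  (b + u) ^ suc k + (b + e) ^ suc k
    ≡⟨ expand b e u ((b + u) ^ k) ((b + e) ^ k) ⟩
  b * ((b + u) ^ k + (b + e) ^ k) + (u * (b + u) ^ k + e * (b + e) ^ k)
    ≤⟨ +-mono-≤ (*-monoʳ-≤ b (^-supermodular k b e u))
                (+-mono-≤ (*-monoʳ-≤ u (^-monoˡ-≤ k (+-monoˡ-≤ u (m≤m+n b e))))
                          (*-monoʳ-≤ e (^-monoˡ-≤ k (m≤m+n (b + e) u)))) ⟩
  b * ((b + e + u) ^ k + b ^ k) + (u * (b + e + u) ^ k + e * (b + e + u) ^ k)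
    ≡⟨ collect b e u ((b + e + u) ^ k) (b ^ k) ⟩
  (b + e + u) ^ suc k + b ^ suc k
    ∎
  where
  open ≤-Reasoning
  expand : ∀ b e u A B → (b + u) * A + (b + e) * B ≡ b * (A + B) + (u * A + e * B)
  expand = solve-∀
  collect : ∀ b e u C D → b * (C + D) + (u * C + e * C) ≡ (b + e + u) * C + b * D
  collect = solve-∀

powSum-spread-≤ : ∀ k {a b c d} → b ≤ d → d ≤ a → a + b ≡ c + d → c ^ k + d ^ k ≤ a ^ k + b ^ k
powSum-spread-≤ k {b = b} {c} b≤d d≤a a+b≡c+d
  with e , refl ← m≤n⇒∃[o]m+o≡n b≤d
  with u , refl ← m≤n⇒∃[o]m+o≡n d≤a
  = subst (λ c → c ^ k + (b + e) ^ k ≤ (b + e + u) ^ k + b ^ k) (sym c≡b+u) (^-supermodular k b e u)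
  where
  shift : ∀ b e u → b + e + u + b ≡ b + u + (b + e)
  shift = solve-∀
  c≡b+u : c ≡ b + u
  c≡b+u = +-cancelʳ-≡ (b + e) c (b + u) (trans (sym a+b≡c+d) (shift b e u))

-- In the next three lemmas x, 1 + x, 2 + x stand for y - 1, y, y + 1, avoiding truncated subtraction.
^-midpoint-convex : ∀ n x → suc x ^ n + suc x ^ n ≤ (2 + x) ^ n + x ^ n
^-midpoint-convex n x = powSum-spread-≤ n (n≤1+n x) (n≤1+n (suc x)) (cong suc (sym (+-suc x x)))

^-central-difference : ∀ n x → x ^ suc n + 2 * suc n * suc x ^ n ≤ (2 + x) ^ suc n
^-central-difference zero    x = ≤-reflexive (+-comm (x * 1) 2)
^-central-difference (suc n) x = +-cancelʳ-≤ (x ^ suc n) _ _ (begin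
  x ^ (2 + n) + 2 * (2 + n) * suc x ^ suc n + x ^ suc n
    ≡⟨ expand x n (x ^ suc n) (suc x ^ n) ⟩
  suc x * (x ^ suc n + 2 * suc n * suc x ^ n) + (suc x ^ suc n + suc x ^ suc n)
    ≤⟨ +-mono-≤ (*-monoʳ-≤ (suc x) (^-central-difference n x)) (^-midpoint-convex (suc n) x) ⟩
  suc x * (2 + x) ^ suc n + ((2 + x) ^ suc n + x ^ suc n)
    ≡⟨ collect x ((2 + x) ^ suc n) (x ^ suc n) ⟩
  (2 + x) ^ (2 + n) + x ^ suc n
    ∎)
  where
  open ≤-Reasoning
  expand : ∀ x n P Q → x * P + 2 * (2 + n) * ((1 + x) * Q) + P
                     ≡ (1 + x) * (P + 2 * (1 + n) * Q) + ((1 + x) * Q + (1 + x) * Q)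
  expand = solve-∀
  collect : ∀ x R P → (1 + x) * R + (R + P) ≡ (2 + x) * R + P
  collect = solve-∀

^-second-difference : ∀ m x → suc x ^ (2 + m) + suc x ^ (2 + m) + (2 + m) * (1 + m) * suc x ^ m
                              ≤ (2 + x) ^ (2 + m) + x ^ (2 + m)
^-second-difference zero    x = ≤-reflexive (base x)
  where
  base : ∀ x → (1 + x) * ((1 + x) * 1) + (1 + x) * ((1 + x) * 1) + 2 * 1 * 1
             ≡ (2 + x) * ((2 + x) * 1) + x * (x * 1)
  base = solve-∀
^-second-difference (suc m) x = +-cancelʳ-≤ (x ^ (2 + m)) _ _ (begin
  suc x ^ (3 + m) + suc x ^ (3 + m) + (3 + m) * (2 + m) * suc x ^ suc m + x ^ (2 + m)
    ≡⟨ expand x m (suc x ^ m) (x ^ (2 + m)) ⟩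
  suc x * (suc x ^ (2 + m) + suc x ^ (2 + m) + (2 + m) * (1 + m) * suc x ^ m)
    + (x ^ (2 + m) + 2 * (2 + m) * suc x ^ suc m)
    ≤⟨ +-mono-≤ (*-monoʳ-≤ (suc x) (^-second-difference m x)) (^-central-difference (suc m) x) ⟩
  suc x * ((2 + x) ^ (2 + m) + x ^ (2 + m)) + (2 + x) ^ (2 + m)
    ≡⟨ collect x ((2 + x) ^ (2 + m)) (x ^ (2 + m)) ⟩
  (2 + x) ^ (3 + m) + x ^ (3 + m) + x ^ (2 + m)
    ∎)
  where
  open ≤-Reasoning
  expand : ∀ x m Y X → (1 + x) * ((1 + x) * ((1 + x) * Y)) + (1 + x) * ((1 + x) * ((1 + x) * Y))
                         + (3 + m) * (2 + m) * ((1 + x) * Y) + X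
                     ≡ (1 + x) * ((1 + x) * ((1 + x) * Y) + (1 + x) * ((1 + x) * Y) + (2 + m) * (1 + m) * Y)
                         + (X + 2 * (2 + m) * ((1 + x) * Y))
  expand = solve-∀
  collect : ∀ x Z X → (1 + x) * (Z + X) + Z ≡ (2 + x) * Z + x * X + X
  collect = solve-∀

powSum-step-gain : ∀ m {x y} → x ≤ y →
  suc y ^ (2 + m) + suc x ^ (2 + m) + (2 + m) * (1 + m) * suc y ^ m ≤ (2 + y) ^ (2 + m) + x ^ (2 + m)
powSum-step-gain m {x} {y} x≤y = +-cancelʳ-≤ (y ^ k + suc y ^ k) _ _ (begin
  suc y ^ k + suc x ^ k + G + (y ^ k + suc y ^ k)
    ≡⟨ regroupˡ (suc y ^ k) (suc x ^ k) G (y ^ k) ⟩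
  (suc x ^ k + y ^ k) + (suc y ^ k + suc y ^ k + G)
    ≤⟨ +-mono-≤ (powSum-spread-≤ k x≤y (n≤1+n y) (cong suc (+-comm y x))) (^-second-difference m y) ⟩
  (suc y ^ k + x ^ k) + ((2 + y) ^ k + y ^ k)
    ≡⟨ regroupʳ (suc y ^ k) (x ^ k) ((2 + y) ^ k) (y ^ k) ⟩
  (2 + y) ^ k + x ^ k + (y ^ k + suc y ^ k)
    ∎)
  where
  open ≤-Reasoning
  k : ℕ
  k = 2 + m
  G : ℕ
  G = (2 + m) * (1 + m) * suc y ^ m
  regroupˡ : ∀ s t g r → s + t + g + (r + s) ≡ (t + r) + (s + s + g)
  regroupˡ = solve-∀
  regroupʳ : ∀ s x z r → (s + x) + (z + r) ≡ z + x + (r + s)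
  regroupʳ = solve-∀

powSum-spread-gain : ∀ m {a b c d} → b < d → d ≤ c → c < a → a + b ≡ c + d →
  c ^ (2 + m) + d ^ (2 + m) + (2 + m) * (1 + m) * c ^ m ≤ a ^ (2 + m) + b ^ (2 + m)
powSum-spread-gain m {a} {b} {suc y} {suc x} (s≤s b≤x) (s≤s x≤y) c<a a+b≡c+d =
  ≤-trans (powSum-step-gain m x≤y)
          (powSum-spread-≤ (2 + m) b≤x x≤a (trans a+b≡c+d (+-suc (suc y) x)))
  where
  x≤a : x ≤ a
  x≤a = ≤-trans x≤y (≤-trans (n≤1+n y) (<⇒≤ c<a))

powSum-gap : ∀ m {a b c d S} → a + b ≡ S → c + d ≡ S → c ⊔ d < a ⊔ b →
  c ^ (2 + m) + d ^ (2 + m) + (2 + m) * (1 + m) * (S / 2) ^ m ≤ a ^ (2 + m) + b ^ (2 + m)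
powSum-gap m {a} {b} {c} {d} {S} a+b≡S c+d≡S cd<ab = begin
  c ^ k + d ^ k + K * (S / 2) ^ m
    ≤⟨ +-monoʳ-≤ (c ^ k + d ^ k) (*-monoʳ-≤ K (^-monoˡ-≤ m (m+n≡o⇒o/2≤m⊔n c d c+d≡S))) ⟩
  c ^ k + d ^ k + K * (c ⊔ d) ^ m
    ≡⟨ cong (_+ K * (c ⊔ d) ^ m) (f[m]+f[n]≡f[m⊔n]+f[m⊓n] (_^ k) c d) ⟩
  (c ⊔ d) ^ k + (c ⊓ d) ^ k + K * (c ⊔ d) ^ m
    ≤⟨ powSum-spread-gain m (m+n≡o+p∧o<m⇒n<p sorted cd<ab) (m⊓n≤m⊔n c d) cd<ab sorted ⟩
  (a ⊔ b) ^ k + (a ⊓ b) ^ k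
    ≡⟨ sym (f[m]+f[n]≡f[m⊔n]+f[m⊓n] (_^ k) a b) ⟩
  a ^ k + b ^ k
    ∎
  where
  open ≤-Reasoning
  k K : ℕ
  k = 2 + m
  K = (2 + m) * (1 + m)
  sorted : (a ⊔ b) + (a ⊓ b) ≡ (c ⊔ d) + (c ⊓ d)
  sorted = begin-equality
    (a ⊔ b) + (a ⊓ b)  ≡⟨ sym (f[m]+f[n]≡f[m⊔n]+f[m⊓n] id a b) ⟩
    a + b              ≡⟨ trans a+b≡S (sym c+d≡S) ⟩
    c + d              ≡⟨ f[m]+f[n]≡f[m⊔n]+f[m⊓n] id c d ⟩
    (c ⊔ d) + (c ⊓ d)  ∎

⊔-⊓-samePair : ∀ {a b c d} → a ⊔ b ≡ c ⊔ d → a ⊓ b ≡ c ⊓ d → SamePair a b c d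
⊔-⊓-samePair {a} {b} {c} {d} max≡ min≡ with ⊔-⊓-sel a b | ⊔-⊓-sel c d
... | inj₁ (p , q) | inj₁ (r , s) = inj₁ (trans (sym p) (trans max≡ r) , trans (sym q) (trans min≡ s))
... | inj₁ (p , q) | inj₂ (r , s) = inj₂ (trans (sym p) (trans max≡ r) , trans (sym q) (trans min≡ s))
... | inj₂ (p , q) | inj₁ (r , s) = inj₂ (trans (sym q) (trans min≡ s) , trans (sym p) (trans max≡ r))
... | inj₂ (p , q) | inj₂ (r , s) = inj₁ (trans (sym q) (trans min≡ s) , trans (sym p) (trans max≡ r))

samePair-⊔ : ∀ {a b c d} → a ⊔ b ≡ c ⊔ d → a + b ≡ c + d → SamePair a b c d
samePair-⊔ {a} {b} {c} {d} max≡ sum≡ = ⊔-⊓-samePair max≡ (+-cancelˡ-≡ (a ⊔ b) (a ⊓ b) (c ⊓ d) (begin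
  (a ⊔ b) + (a ⊓ b)  ≡⟨ sym (f[m]+f[n]≡f[m⊔n]+f[m⊓n] id a b) ⟩
  a + b              ≡⟨ sum≡ ⟩
  c + d              ≡⟨ f[m]+f[n]≡f[m⊔n]+f[m⊓n] id c d ⟩
  (c ⊔ d) + (c ⊓ d)  ≡⟨ cong (_+ (c ⊓ d)) (sym max≡) ⟩
  (a ⊔ b) + (c ⊓ d)  ∎))
  where open ≡-Reasoning

m≤3*[m/2] : ∀ {m} → 2 ≤ m → m ≤ 3 * (m / 2)
m≤3*[m/2] {m} 2≤m = begin
  m                    ≡⟨ m≡m%n+[m/n]*n m 2 ⟩
  m % 2 + m / 2 * 2    ≤⟨ +-monoˡ-≤ (m / 2 * 2) (≤-trans (s≤s⁻¹ (m%n<n m 2)) (/-monoˡ-≤ 2 2≤m)) ⟩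
  m / 2 + m / 2 * 2    ≡⟨ cong (m / 2 +_) (*-comm (m / 2) 2) ⟩
  3 * (m / 2)          ∎
  where open ≤-Reasoning

^-distribʳ-* : ∀ m n o → (m * n) ^ o ≡ m ^ o * n ^ o
^-distribʳ-* m n zero    = refl
^-distribʳ-* m n (suc o) =
  trans (cong (m * n *_) (^-distribʳ-* m n o)) (interchange m n (m ^ o) (n ^ o))

c*m^k≤3^k*[c*[m/2]^k] : ∀ c k {m} → 2 ≤ m → c * m ^ k ≤ 3 ^ k * (c * (m / 2) ^ k)
c*m^k≤3^k*[c*[m/2]^k] c k {m} 2≤m = begin
  c * m ^ k                  ≤⟨ *-monoʳ-≤ c (^-monoˡ-≤ k (m≤3*[m/2] 2≤m)) ⟩
  c * (3 * (m / 2)) ^ k      ≡⟨ cong (c *_) (^-distribʳ-* 3 (m / 2) k) ⟩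
  c * (3 ^ k * (m / 2) ^ k)  ≡⟨ x∙yz≈y∙xz c (3 ^ k) ((m / 2) ^ k) ⟩
  3 ^ k * (c * (m / 2) ^ k)  ∎
  where open ≤-Reasoning

m+g≤n⇒g≤∣m-n∣ : ∀ m n {g} → m + g ≤ n → g ≤ ∣ ℤ.+ m ℤ.- ℤ.+ n ∣
m+g≤n⇒g≤∣m-n∣ m n {g} m+g≤n = begin
  g                  ≤⟨ m+n≤o⇒m≤o∸n g (subst (_≤ n) (+-comm m g) m+g≤n) ⟩
  n ∸ m              ≡⟨ sym (ℤ.∣⊖∣-≤ (m+n≤o⇒m≤o m m+g≤n)) ⟩
  ∣ m ⊖ n ∣          ≡⟨ cong ∣_∣ (sym (ℤ.m-n≡m⊖n m n)) ⟩
  ∣ ℤ.+ m ℤ.- ℤ.+ n ∣    ∎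
  where open ≤-Reasoning

n+g≤m⇒g≤∣m-n∣ : ∀ m n {g} → n + g ≤ m → g ≤ ∣ ℤ.+ m ℤ.- ℤ.+ n ∣
n+g≤m⇒g≤∣m-n∣ m n n+g≤m = subst (_ ≤_) (ℤ.∣i-j∣≡∣j-i∣ (ℤ.+ n) (ℤ.+ m)) (m+g≤n⇒g≤∣m-n∣ n m n+g≤m)
theorem2p6 : (k a b c d S : ℕ) → 2 ≤ k → a + b ≡ S → c + d ≡ S → 2 ≤ S
    → ¬ SamePair a b c d
    → (k * (k ∸ 1) * (S / 2) ^ (k ∸ 2) ≤ absDiffPow k a b c d)
      × (k * (k ∸ 1) * S ^ (k ∸ 2) ≤ 3 ^ (k ∸ 2) * (k * (k ∸ 1) * (S / 2) ^ (k ∸ 2)))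
theorem2p6 (suc zero) _ _ _ _ _ (s≤s ())
theorem2p6 (suc (suc m)) a b c d S _ a+b≡S c+d≡S 2≤S ¬same =
  gap , c*m^k≤3^k*[c*[m/2]^k] ((2 + m) * (1 + m)) m 2≤S
  where
  gap : (2 + m) * (1 + m) * (S / 2) ^ m ≤ absDiffPow (2 + m) a b c d
  gap with <-cmp (a ⊔ b) (c ⊔ d)
  ... | tri< ab<cd _ _ = m+g≤n⇒g≤∣m-n∣ (a ^ (2 + m) + b ^ (2 + m)) (c ^ (2 + m) + d ^ (2 + m))
                           (powSum-gap m {c} {d} {a} {b} c+d≡S a+b≡S ab<cd)
  ... | tri≈ _ ab≡cd _ = ⊥-elim (¬same (samePair-⊔ {a} {b} {c} {d} ab≡cd (trans a+b≡S (sym c+d≡S))))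
  ... | tri> _ _ cd<ab = n+g≤m⇒g≤∣m-n∣ (a ^ (2 + m) + b ^ (2 + m)) (c ^ (2 + m) + d ^ (2 + m))
                           (powSum-gap m {a} {b} {c} {d} a+b≡S c+d≡S cd<ab)
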